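{- Fix $B\ge 2$, a BFU false-positive rate $p\in[0,1)$, and a bound $V$ on the number of sets containing the query. For a RAMBO data structure on $K$ sets with $B\times R$ BFUs, in order for the probability $\delta$ of reporting an incorrect membership status of a query for any of the $K$ sets to be at most a prescribed $\delta\in(0,1)$, it suffices to take $$R=O(\log K-\log\delta)$$ repetitions.
   Context: RAMBO data structure: choose $R$ independent partition hash functions $\phi_1,\dots,\phi_R:\{1,\dots,K\}\to\{1,\dots,B\}$, each assigning every set index uniformly at random (independently across sets). Cell $(b,r)$ stores a Bloom Filter (BFU) for the union of the sets $S_i$ with $\phi_r(i)=b$; BFUs have no false negatives and false-positive rate $p$, independently across cells. A query $q$ (contained in at most $V$ sets) is answered by taking, for each $r$, the union $G_r$ of the index sets of all cells in repetition $r$ whose BFU answers "present", and outputting $\bigcap_r G_r$ as the indices of the sets containing $q$.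
   Formalization: The BFU false-positive rate p and the error probability δ range over the rationals in $[0,1)$ and $(0,1)$ respectively, rather than over the reals. -}

module Defs where

open import Data.Bool using (Bool; true; false; _∧_; _∨_; not; if_then_else_)
open import Data.Nat using (ℕ; zero; suc; NonZero)
open import Data.Fin using (Fin) renaming (_≟_ to _≟ᶠ_)
open import Data.Fin.Subset using (Subset)
open import Data.List using (List; []; _∷_; [_]; map; concatMap; foldr; allFin)
open import Data.Vec using (lookup)
open import Data.Vec.Functional using () renaming (_∷_ to _∷ᶠ_)
open import Data.Rational using (ℚ; 0ℚ; 1ℚ; _+_; _*_; _-_; _/_)
open import Data.Integer using (+_)
open import Relation.Nullary using (does)
import Data.Bool.Properties as BoolP

allFuns : {A : Set} (n : ℕ) → List A → List (Fin n → A)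
allFuns zero    xs = [ (λ ()) ]
allFuns (suc n) xs = concatMap (λ x → map (λ f → x ∷ᶠ f) (allFuns n xs)) xs

sumℚ : {A : Set} → List A → (A → ℚ) → ℚ
sumℚ xs f = foldr (λ x acc → f x + acc) 0ℚ xs

prodℚ : {A : Set} → List A → (A → ℚ) → ℚ
prodℚ xs f = foldr (λ x acc → f x * acc) 1ℚ xs

allᵇ : (n : ℕ) → (Fin n → Bool) → Bool
allᵇ n f = foldr (λ i acc → f i ∧ acc) true (allFin n)

anyᵇ : (n : ℕ) → (Fin n → Bool) → Bool
anyᵇ n f = foldr (λ i acc → f i ∨ acc) false (allFin n)

-- Partition hash functions: φ r i = cell (in repetition r) of set i.
Hashes : (B K R : ℕ) → Set
Hashes B K R = Fin R → Fin K → Fin B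

-- BFU false-positive coins: c r b = true iff the BFU in cell (b,r)
-- produces a false positive (it would answer "present" even if empty of q).
Coins : (B R : ℕ) → Set
Coins B R = Fin R → Fin B → Bool

-- BFU answer of cell (b,r): no false negatives (present whenever some set
-- of the cell contains q), plus the false-positive coin.
bfuAnswer : (B K R : ℕ) → Subset K → Hashes B K R → Coins B R → Fin R → Fin B → Bool
bfuAnswer B K R Q φ c r b =
  anyᵇ K (λ j → lookup Q j ∧ does (φ r j ≟ᶠ b)) ∨ c r b

-- Reported index set: ⋂_r G_r, where i ∈ G_r iff cell (φ r i , r) answers present.
rambo-output : (B K R : ℕ) → Subset K → Hashes B K R → Coins B R → Fin K → Bool
rambo-output B K R Q φ c i = allᵇ R (λ r → bfuAnswer B K R Q φ c r (φ r i))

rambo-error : (B K R : ℕ) → Subset K → Hashes B K R → Coins B R → Bool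
rambo-error B K R Q φ c =
  not (allᵇ K (λ i → does (BoolP._≟_ (rambo-output B K R Q φ c i) (lookup Q i))))

powℚ : ℚ → ℕ → ℚ
powℚ x zero    = 1ℚ
powℚ x (suc n) = x * powℚ x n

coinWeight : (B R : ℕ) → ℚ → Coins B R → ℚ
coinWeight B R p c =
  prodℚ (allFin R) (λ r → prodℚ (allFin B) (λ b → if c r b then p else (1ℚ - p)))

-- Exact probability that RAMBO reports an incorrect membership status, for a
-- query q whose true membership set is Q: hash functions uniform and independent
-- (each of the B^(K·R) choices has weight (1/B)^(K·R)), BFU false positives
-- independent Bernoulli(p) per cell.
rambo-errorProb : (B K R : ℕ) → .{{_ : NonZero B}} → ℚ → Subset K → ℚ
rambo-errorProb B K R p Q =
  sumℚ (allFuns R (allFuns K (allFin B))) λ φ →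
    sumℚ (allFuns R (allFuns B (true ∷ false ∷ []))) λ c →
      powℚ (+ 1 / B) (K Data.Nat.* R) * coinWeight B R p c
        * (if rambo-error B K R Q φ c then 1ℚ else 0ℚ)

{-# OPTIONS --safe #-}
module Submission where

-- Since BFUs have no false negatives, RAMBO errs only by reporting some set i ∉ Q, and that
-- needs the cell of i to answer "present" in every repetition. By the union bound and the
-- independence of the repetitions, the error probability is at most Σᵢ Pᵢ^R, where Pᵢ is the
-- probability of this in a single repetition. The cell of i certainly answers "absent" when the
-- partition sends i to a cell c₀ and the (at most V) sets containing q to another cell c₁, and
-- the BFU of c₀ does not err; this has probability at least ε = B^-(V+1) (1 - p), so the error
-- probability is at most K (1 - ε)^R. Bernoulli's inequality gives (1 - ε)^C ≤ 1/2 once C ε ≥ 1,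
-- hence K (1 - ε)^R ≤ δ as soon as R ≥ C log₂ (K / δ).

open import Defs
open import Data.Nat using (ℕ; NonZero; _≤_)
open import Data.Fin.Subset using (Subset; ∣_∣)
open import Data.Product using (∃-syntax)
open import Data.Integer using (+_)
open import Data.Rational using (ℚ; 0ℚ; 1ℚ; _/_; _*_) renaming (_≤_ to _≤ℚ_; _<_ to _<ℚ_)

open import Data.Bool using (Bool; true; false; _∧_; _∨_; not; if_then_else_)
open import Data.Bool.Properties using (∧-conicalˡ; ∧-conicalʳ; ∨-zeroʳ; not-injective) renaming (_≟_ to _≟ᵇ_)
open import Data.Empty using (⊥-elim)
open import Data.Fin using (Fin; zero; suc) renaming (_≟_ to _≟ᶠ_)
import Data.Integer as ℤ
import Data.Integer.Properties as ℤP
open import Data.List using (List; []; _∷_; map; concatMap; foldr; allFin; length; _++_)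
open import Data.List.Membership.Propositional using (_∈_)
open import Data.List.Membership.Propositional.Properties using (∈-allFin)
open import Data.List.Properties using (foldr-map; map-tabulate; length-tabulate)
open import Data.List.Relation.Unary.Any using (here; there)
open import Data.Nat using (zero; suc; z≤n; s≤s) renaming (_*_ to _*ℕ_)
import Data.Nat as ℕ
import Data.Nat.Properties as ℕP
open import Data.Nat.Coprimality using (1-coprimeTo) renaming (sym to coprime-sym)
open import Data.Product using (Σ; _,_)
open import Data.Rational using (_+_; _-_; -_; mkℚ; *≤*)
import Data.Rational as ℚ
import Data.Rational.Properties as ℚP
import Data.Vec as Vec
open import Data.Vec using (lookup)
open import Data.Vec.Functional using () renaming (_∷_ to _∷ᶠ_)
open import Function using (id; _∘_)
open import Relation.Nullary using (does; yes; no; ¬_)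
open import Relation.Nullary.Decidable using (dec-true; dec-false)
open import Relation.Nullary.Decidable.Core using (dec⇒maybe)
open import Relation.Binary.PropositionalEquality
open import Tactic.RingSolver using (solve-∀)
open import Tactic.RingSolver.Core.AlmostCommutativeRing using (AlmostCommutativeRing; fromCommutativeRing)

ℚ-ring : AlmostCommutativeRing _ _
ℚ-ring = fromCommutativeRing ℚP.+-*-commutativeRing (λ x → dec⇒maybe (0ℚ ℚP.≟ x))

𝟙 : Bool → ℚ
𝟙 b = if b then 1ℚ else 0ℚ

ι : ℕ → ℚ
ι n = + n / 1

0≤1 : 0ℚ ≤ℚ 1ℚ
0≤1 = *≤* (ℤ.+≤+ z≤n)

0≤𝟙 : ∀ b → 0ℚ ≤ℚ 𝟙 b
0≤𝟙 true  = 0≤1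
0≤𝟙 false = ℚP.≤-refl

p≤p+q : ∀ {p q} → 0ℚ ≤ℚ q → p ≤ℚ p + q
p≤p+q {p} 0≤q = subst (_≤ℚ p + _) (ℚP.+-identityʳ p) (ℚP.+-monoʳ-≤ p 0≤q)

p≤q+p : ∀ {p q} → 0ℚ ≤ℚ q → p ≤ℚ q + p
p≤q+p {p} {q} 0≤q = subst (p ≤ℚ_) (ℚP.+-comm p q) (p≤p+q 0≤q)

*-nonNeg : ∀ {a b} → 0ℚ ≤ℚ a → 0ℚ ≤ℚ b → 0ℚ ≤ℚ a * b
*-nonNeg {a} {b} 0≤a 0≤b =
  ℚP.nonNegative⁻¹ _ {{ℚP.nonNeg*nonNeg⇒nonNeg a {{ℚ.nonNegative 0≤a}} b {{ℚ.nonNegative 0≤b}}}}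

*-pos : ∀ {a b} → 0ℚ <ℚ a → 0ℚ <ℚ b → 0ℚ <ℚ a * b
*-pos {a} {b} 0<a 0<b = ℚP.positive⁻¹ _ {{ℚP.pos*pos⇒pos a {{ℚ.positive 0<a}} b {{ℚ.positive 0<b}}}}

*-mono-≤-nonNeg : ∀ {a b c d} → 0ℚ ≤ℚ a → 0ℚ ≤ℚ d → a ≤ℚ b → c ≤ℚ d → a * c ≤ℚ b * d
*-mono-≤-nonNeg {a} {b} {c} {d} 0≤a 0≤d a≤b c≤d = ℚP.≤-trans
  (ℚP.*-monoˡ-≤-nonNeg a {{ℚ.nonNegative 0≤a}} c≤d)
  (ℚP.*-monoʳ-≤-nonNeg d {{ℚ.nonNegative 0≤d}} a≤b)

0≤1-p : ∀ {p} → p ≤ℚ 1ℚ → 0ℚ ≤ℚ 1ℚ - p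
0≤1-p {p} p≤1 = subst (_≤ℚ 1ℚ - p) (ℚP.+-inverseʳ p) (ℚP.+-monoˡ-≤ (- p) p≤1)

0<1-p : ∀ {p} → p <ℚ 1ℚ → 0ℚ <ℚ 1ℚ - p
0<1-p {p} p<1 = subst (_<ℚ 1ℚ - p) (ℚP.+-inverseʳ p) (ℚP.+-monoˡ-< (- p) p<1)

1-p≤1 : ∀ {p} → 0ℚ ≤ℚ p → 1ℚ - p ≤ℚ 1ℚ
1-p≤1 {p} 0≤p = subst (1ℚ - p ≤ℚ_) (ℚP.+-identityʳ 1ℚ) (ℚP.+-monoʳ-≤ 1ℚ (ℚP.neg-antimono-≤ 0≤p))

+≤1⇒≤1- : ∀ {a b c} → a + b ≤ℚ 1ℚ → c ≤ℚ b → a ≤ℚ 1ℚ - c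
+≤1⇒≤1- {a} {b} {c} a+b≤1 c≤b = ℚP.≤-trans
  (subst (_≤ℚ 1ℚ - b) (cancel a b) (ℚP.+-monoˡ-≤ (- b) a+b≤1))
  (ℚP.+-monoʳ-≤ 1ℚ (ℚP.neg-antimono-≤ c≤b))
  where
  cancel : ∀ a b → a + b - b ≡ a
  cancel = solve-∀ ℚ-ring

ι-suc : ∀ n → ι (suc n) ≡ 1ℚ + ι n
ι-suc n = begin
  ι (suc n)                ≡⟨ cong (_/ 1) (cong (ℤ._+_ (+ 1)) (sym (ℤP.*-identityʳ (+ n)))) ⟩
  1ℚ + mkℚ (+ n) 0 n⊥1     ≡⟨ cong (_+_ 1ℚ) (sym (ℚP.normalize-coprime n⊥1)) ⟩
  1ℚ + ι n                 ∎
  where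
  open ≡-Reasoning
  n⊥1 = coprime-sym (1-coprimeTo n)

ι-*-inverse : ∀ m → ι (suc m) * (+ 1 / suc m) ≡ 1ℚ
ι-*-inverse m = begin
  ι (suc m) * (+ 1 / suc m)   ≡⟨ cong₂ _*_ (ℚP.normalize-coprime (coprime-sym (1-coprimeTo (suc m))))
                                            (ℚP.normalize-coprime (1-coprimeTo (suc m))) ⟩
  m/1 * ℚ.1/ m/1              ≡⟨ ℚP.*-inverseʳ m/1 ⟩
  1ℚ                          ∎
  where
  open ≡-Reasoning
  m/1 = mkℚ (+ suc m) 0 (coprime-sym (1-coprimeTo (suc m)))

0≤ι : ∀ n → 0ℚ ≤ℚ ι n
0≤ι n = ℚP.nonNegative⁻¹ (ι n) {{ℚP.normalize-nonNeg n 1}}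

0<1/suc : ∀ m → 0ℚ <ℚ + 1 / suc m
0<1/suc m = subst (0ℚ <ℚ_) (sym (ℚP.normalize-coprime (1-coprimeTo (suc m)))) (ℚ.*<* (ℤ.+<+ (s≤s z≤n)))

1/suc≤1 : ∀ m → + 1 / suc m ≤ℚ 1ℚ
1/suc≤1 m = subst (_≤ℚ 1ℚ) (sym (ℚP.normalize-coprime (1-coprimeTo (suc m)))) (*≤* (ℤ.+≤+ (s≤s z≤n)))

1/suc-denominator≤ : ∀ r → 0ℚ <ℚ r → + 1 / suc (ℚ.ℚ.denominator-1 r) ≤ℚ r
1/suc-denominator≤ r@(mkℚ (+ suc n) d-1 _) 0<r =
  subst (_≤ℚ r) (sym (ℚP.normalize-coprime (1-coprimeTo (suc d-1))))
    (*≤* (subst₂ ℤ._≤_ (ℤP.pos-* 1 (suc d-1)) (ℤP.pos-* (suc n) (suc d-1))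
      (ℤ.+≤+ (ℕP.*-monoˡ-≤ (suc d-1) {1} {suc n} (s≤s z≤n)))))
1/suc-denominator≤ (mkℚ (+ zero) _ _)   0<r with () ← ℚ.positive 0<r
1/suc-denominator≤ (mkℚ ℤ.-[1+ _ ] _ _) 0<r with () ← ℚ.positive 0<r

archimedean : ∀ ε → 0ℚ <ℚ ε → ∃[ n ] 1ℚ ≤ℚ ι (suc n) * ε
archimedean ε 0<ε = d-1 , subst (_≤ℚ ι (suc d-1) * ε) (ι-*-inverse d-1)
  (ℚP.*-monoˡ-≤-nonNeg (ι (suc d-1)) {{ℚ.nonNegative (0≤ι (suc d-1))}} (1/suc-denominator≤ ε 0<ε))
  where
  d-1 = ℚ.ℚ.denominator-1 ε

pow-1ˡ : ∀ n → powℚ 1ℚ n ≡ 1ℚ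
pow-1ˡ zero    = refl
pow-1ˡ (suc n) = trans (ℚP.*-identityˡ _) (pow-1ˡ n)

pow-+ : ∀ x m n → powℚ x (m ℕ.+ n) ≡ powℚ x m * powℚ x n
pow-+ x zero    n = sym (ℚP.*-identityˡ _)
pow-+ x (suc m) n = trans (cong (x *_) (pow-+ x m n)) (sym (ℚP.*-assoc x (powℚ x m) (powℚ x n)))

pow-distrib-* : ∀ x y n → powℚ (x * y) n ≡ powℚ x n * powℚ y n
pow-distrib-* x y zero    = refl
pow-distrib-* x y (suc n) =
  trans (cong (x * y *_) (pow-distrib-* x y n)) (interchange x y (powℚ x n) (powℚ y n))
  where
  interchange : ∀ a b c d → a * b * (c * d) ≡ a * c * (b * d)
  interchange = solve-∀ ℚ-ring

pow-* : ∀ x m n → powℚ x (m *ℕ n) ≡ powℚ (powℚ x m) n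
pow-* x zero    n = sym (pow-1ˡ n)
pow-* x (suc m) n = begin
  powℚ x (n ℕ.+ m *ℕ n)         ≡⟨ pow-+ x n (m *ℕ n) ⟩
  powℚ x n * powℚ x (m *ℕ n)    ≡⟨ cong (powℚ x n *_) (pow-* x m n) ⟩
  powℚ x n * powℚ (powℚ x m) n  ≡⟨ sym (pow-distrib-* x (powℚ x m) n) ⟩
  powℚ (x * powℚ x m) n         ∎
  where open ≡-Reasoning

pow-comm : ∀ x m n → powℚ (powℚ x m) n ≡ powℚ (powℚ x n) m
pow-comm x m n = trans (sym (pow-* x m n)) (trans (cong (powℚ x) (ℕP.*-comm m n)) (pow-* x n m))

pow-nonNeg : ∀ {x} n → 0ℚ ≤ℚ x → 0ℚ ≤ℚ powℚ x n
pow-nonNeg zero    0≤x = 0≤1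
pow-nonNeg (suc n) 0≤x = *-nonNeg 0≤x (pow-nonNeg n 0≤x)

pow-pos : ∀ {x} n → 0ℚ <ℚ x → 0ℚ <ℚ powℚ x n
pow-pos zero    0<x = ℚ.*<* (ℤ.+<+ (s≤s z≤n))
pow-pos (suc n) 0<x = *-pos 0<x (pow-pos n 0<x)

pow-mono-≤ : ∀ {x y} n → 0ℚ ≤ℚ x → x ≤ℚ y → powℚ x n ≤ℚ powℚ y n
pow-mono-≤ zero    0≤x x≤y = ℚP.≤-refl
pow-mono-≤ (suc n) 0≤x x≤y =
  *-mono-≤-nonNeg 0≤x (pow-nonNeg n (ℚP.≤-trans 0≤x x≤y)) x≤y (pow-mono-≤ n 0≤x x≤y)

pow-≤1 : ∀ {x} n → 0ℚ ≤ℚ x → x ≤ℚ 1ℚ → powℚ x n ≤ℚ 1ℚ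
pow-≤1 {x} n 0≤x x≤1 = subst (powℚ x n ≤ℚ_) (pow-1ˡ n) (pow-mono-≤ n 0≤x x≤1)

pow-antimonoʳ-≤ : ∀ {x m n} → 0ℚ ≤ℚ x → x ≤ℚ 1ℚ → m ≤ n → powℚ x n ≤ℚ powℚ x m
pow-antimonoʳ-≤ {n = n} 0≤x x≤1 z≤n     = pow-≤1 n 0≤x x≤1
pow-antimonoʳ-≤ {x}     0≤x x≤1 (s≤s m≤n) =
  ℚP.*-monoˡ-≤-nonNeg x {{ℚ.nonNegative 0≤x}} (pow-antimonoʳ-≤ 0≤x x≤1 m≤n)

pow-mono-< : ∀ {x y} n → 0ℚ ≤ℚ x → x <ℚ y → powℚ x (suc n) <ℚ powℚ y (suc n)
pow-mono-< {x} {y} zero    0≤x x<y = subst₂ _<ℚ_ (sym (ℚP.*-identityʳ x)) (sym (ℚP.*-identityʳ y)) x<y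
pow-mono-< {x} {y} (suc n) 0≤x x<y = ℚP.≤-<-trans
  (ℚP.*-monoˡ-≤-nonNeg x {{ℚ.nonNegative 0≤x}} (ℚP.<⇒≤ (pow-mono-< n 0≤x x<y)))
  (ℚP.*-monoˡ-<-pos (powℚ y (suc n)) {{ℚ.positive (pow-pos (suc n) (ℚP.≤-<-trans 0≤x x<y))}} x<y)

pow-cancel-≤ : ∀ {x y} n → 0ℚ ≤ℚ y → powℚ x (suc n) ≤ℚ powℚ y (suc n) → x ≤ℚ y
pow-cancel-≤ {x} {y} n 0≤y xⁿ≤yⁿ with x ℚP.≤? y
... | yes x≤y = x≤y
... | no  x≰y = ⊥-elim (ℚP.<-irrefl refl (ℚP.<-≤-trans (pow-mono-< n 0≤y (ℚP.≰⇒> x≰y)) xⁿ≤yⁿ))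

bernoulli : ∀ {e} → 0ℚ ≤ℚ e → e ≤ℚ 1ℚ → ∀ n → powℚ (1ℚ - e) n * (1ℚ + ι n * e) ≤ℚ 1ℚ
bernoulli {e} 0≤e e≤1 zero = ℚP.≤-reflexive (base e)
  where
  base : ∀ e → 1ℚ * (1ℚ + 0ℚ * e) ≡ 1ℚ
  base = solve-∀ ℚ-ring
bernoulli {e} 0≤e e≤1 (suc n) = begin
  powℚ (1ℚ - e) (suc n) * (1ℚ + ι (suc n) * e)
    ≡⟨ cong (λ k → powℚ (1ℚ - e) (suc n) * (1ℚ + k * e)) (ι-suc n) ⟩
  (1ℚ - e) * xⁿ * (1ℚ + (1ℚ + ι n) * e)
    ≡⟨ step e (ι n) xⁿ ⟩
  xⁿ * ((1ℚ + ι n * e) - e * e * (1ℚ + ι n))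
    ≤⟨ ℚP.*-monoˡ-≤-nonNeg xⁿ {{ℚ.nonNegative 0≤xⁿ}} (loss≤ (1ℚ + ι n * e) _ 0≤e²[1+n]) ⟩
  xⁿ * (1ℚ + ι n * e)
    ≤⟨ bernoulli 0≤e e≤1 n ⟩
  1ℚ ∎
  where
  open ℚP.≤-Reasoning
  xⁿ = powℚ (1ℚ - e) n
  0≤xⁿ : 0ℚ ≤ℚ xⁿ
  0≤xⁿ = pow-nonNeg n (0≤1-p e≤1)
  0≤e²[1+n] : 0ℚ ≤ℚ e * e * (1ℚ + ι n)
  0≤e²[1+n] = *-nonNeg (*-nonNeg 0≤e 0≤e) (subst (0ℚ ≤ℚ_) (ι-suc n) (0≤ι (suc n)))
  step : ∀ e k x → (1ℚ - e) * x * (1ℚ + (1ℚ + k) * e) ≡ x * ((1ℚ + k * e) - e * e * (1ℚ + k))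
  step = solve-∀ ℚ-ring
  loss≤ : ∀ a b → 0ℚ ≤ℚ b → a - b ≤ℚ a
  loss≤ a b 0≤b = subst (a - b ≤ℚ_) (ℚP.+-identityʳ a) (ℚP.+-monoʳ-≤ a (ℚP.neg-antimono-≤ 0≤b))

½ : ℚ
½ = + 1 / 2

0≤½ : 0ℚ ≤ℚ ½
0≤½ = ℚP.<⇒≤ (0<1/suc 1)

pow-halves : ∀ {e} n → 0ℚ ≤ℚ e → e ≤ℚ 1ℚ → 1ℚ ≤ℚ ι n * e → powℚ (1ℚ - e) n ≤ℚ ½
pow-halves {e} n 0≤e e≤1 1≤ne = begin
  xⁿ                  ≡⟨ sym (ℚP.*-identityʳ xⁿ) ⟩
  xⁿ * 1ℚ             ≡⟨ cong (xⁿ *_) (sym (ι-*-inverse 1)) ⟩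
  xⁿ * (ι 2 * ½)      ≡⟨ sym (ℚP.*-assoc xⁿ (ι 2) ½) ⟩
  xⁿ * ι 2 * ½        ≤⟨ ℚP.*-monoʳ-≤-nonNeg ½ {{ℚ.nonNegative 0≤½}} twice≤1 ⟩
  1ℚ * ½              ≡⟨ ℚP.*-identityˡ ½ ⟩
  ½                   ∎
  where
  open ℚP.≤-Reasoning
  xⁿ = powℚ (1ℚ - e) n
  twice≤1 : xⁿ * ι 2 ≤ℚ 1ℚ
  twice≤1 = ℚP.≤-trans
    (ℚP.*-monoˡ-≤-nonNeg xⁿ {{ℚ.nonNegative (pow-nonNeg n (0≤1-p e≤1))}} (ℚP.+-monoʳ-≤ 1ℚ 1≤ne))
    (bernoulli 0≤e e≤1 n)

power-decay-≤ : ∀ {x δ} K R n → 0ℚ ≤ℚ x → 0ℚ ≤ℚ δ → powℚ x (suc n) ≤ℚ ½ →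
  powℚ (ι K) (suc n) ≤ℚ powℚ δ (suc n) * powℚ (ι 2) R → ι K * powℚ x R ≤ℚ δ
power-decay-≤ {x} {δ} K R n 0≤x 0≤δ xᶜ≤½ Kᶜ≤δᶜ2ᴿ = pow-cancel-≤ n 0≤δ (begin
  powℚ (ι K * powℚ x R) C                         ≡⟨ pow-distrib-* (ι K) (powℚ x R) C ⟩
  powℚ (ι K) C * powℚ (powℚ x R) C                ≡⟨ cong (powℚ (ι K) C *_) (pow-comm x R C) ⟩
  powℚ (ι K) C * powℚ (powℚ x C) R                ≤⟨ ℚP.*-monoˡ-≤-nonNeg (powℚ (ι K) C) {{ℚ.nonNegative 0≤Kᶜ}}
                                                       (pow-mono-≤ R (pow-nonNeg C 0≤x) xᶜ≤½) ⟩
  powℚ (ι K) C * powℚ ½ R                         ≤⟨ ℚP.*-monoʳ-≤-nonNeg (powℚ ½ R) {{ℚ.nonNegative 0≤½ᴿ}} Kᶜ≤δᶜ2ᴿ ⟩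
  powℚ δ C * powℚ (ι 2) R * powℚ ½ R              ≡⟨ ℚP.*-assoc (powℚ δ C) _ _ ⟩
  powℚ δ C * (powℚ (ι 2) R * powℚ ½ R)            ≡⟨ cong (powℚ δ C *_) (sym (pow-distrib-* (ι 2) ½ R)) ⟩
  powℚ δ C * powℚ (ι 2 * ½) R                     ≡⟨ cong (λ y → powℚ δ C * powℚ y R) (ι-*-inverse 1) ⟩
  powℚ δ C * powℚ 1ℚ R                            ≡⟨ cong (powℚ δ C *_) (pow-1ˡ R) ⟩
  powℚ δ C * 1ℚ                                   ≡⟨ ℚP.*-identityʳ (powℚ δ C) ⟩
  powℚ δ C                                        ∎)
  where
  open ℚP.≤-Reasoning
  C = suc n
  0≤Kᶜ : 0ℚ ≤ℚ powℚ (ι K) C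
  0≤Kᶜ = pow-nonNeg C (0≤ι K)
  0≤½ᴿ : 0ℚ ≤ℚ powℚ ½ R
  0≤½ᴿ = pow-nonNeg R 0≤½

-- Once R ≥ C log₂ (K / δ), the tail K (1 - e)^R is at most δ.
geometric-tail : ∀ {e} → 0ℚ <ℚ e → e ≤ℚ 1ℚ →
  ∃[ C ] (∀ K R δ → 0ℚ ≤ℚ δ →
    powℚ (ι K) C ≤ℚ powℚ δ C * powℚ (ι 2) R → ι K * powℚ (1ℚ - e) R ≤ℚ δ)
geometric-tail {e} 0<e e≤1 with archimedean e 0<e
... | n , 1≤ne = suc n , λ K R δ 0≤δ →
  power-decay-≤ K R n (0≤1-p e≤1) 0≤δ (pow-halves (suc n) (ℚP.<⇒≤ 0<e) e≤1 1≤ne)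

-- Finite sums and products over lists

module _ {A : Set} where

  sum-cong : ∀ xs {f g : A → ℚ} → (∀ x → f x ≡ g x) → sumℚ xs f ≡ sumℚ xs g
  sum-cong []       f≗g = refl
  sum-cong (x ∷ xs) f≗g = cong₂ _+_ (f≗g x) (sum-cong xs f≗g)

  prod-cong : ∀ xs {f g : A → ℚ} → (∀ x → f x ≡ g x) → prodℚ xs f ≡ prodℚ xs g
  prod-cong []       f≗g = refl
  prod-cong (x ∷ xs) f≗g = cong₂ _*_ (f≗g x) (prod-cong xs f≗g)

  sum-++ : ∀ xs ys (f : A → ℚ) → sumℚ (xs ++ ys) f ≡ sumℚ xs f + sumℚ ys f
  sum-++ []       ys f = sym (ℚP.+-identityˡ _)
  sum-++ (x ∷ xs) ys f = trans (cong (_+_ (f x)) (sum-++ xs ys f)) (sym (ℚP.+-assoc (f x) _ _))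

  sum-0 : ∀ (xs : List A) → sumℚ xs (λ _ → 0ℚ) ≡ 0ℚ
  sum-0 []       = refl
  sum-0 (x ∷ xs) = trans (ℚP.+-identityˡ _) (sum-0 xs)

  sum-+ : ∀ xs (f g : A → ℚ) → sumℚ xs (λ x → f x + g x) ≡ sumℚ xs f + sumℚ xs g
  sum-+ []       f g = refl
  sum-+ (x ∷ xs) f g =
    trans (cong (_+_ (f x + g x)) (sum-+ xs f g)) (interchange (f x) (g x) (sumℚ xs f) (sumℚ xs g))
    where
    interchange : ∀ a b c d → a + b + (c + d) ≡ a + c + (b + d)
    interchange = solve-∀ ℚ-ring

  *-distribˡ-sum : ∀ a xs (f : A → ℚ) → a * sumℚ xs f ≡ sumℚ xs (λ x → a * f x)
  *-distribˡ-sum a []       f = ℚP.*-zeroʳ a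
  *-distribˡ-sum a (x ∷ xs) f =
    trans (ℚP.*-distribˡ-+ a (f x) (sumℚ xs f)) (cong (_+_ (a * f x)) (*-distribˡ-sum a xs f))

  *-distribʳ-sum : ∀ a xs (f : A → ℚ) → sumℚ xs f * a ≡ sumℚ xs (λ x → f x * a)
  *-distribʳ-sum a xs f = trans (ℚP.*-comm (sumℚ xs f) a)
    (trans (*-distribˡ-sum a xs f) (sum-cong xs (λ x → ℚP.*-comm a (f x))))

  sum-const : ∀ xs c → sumℚ xs (λ (_ : A) → c) ≡ ι (length xs) * c
  sum-const []       c = sym (ℚP.*-zeroˡ c)
  sum-const (x ∷ xs) c = begin
    c + sumℚ xs (λ _ → c)     ≡⟨ cong (_+_ c) (sum-const xs c) ⟩
    c + ι (length xs) * c     ≡⟨ distrib c (ι (length xs)) ⟩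
    (1ℚ + ι (length xs)) * c  ≡⟨ cong (_* c) (sym (ι-suc (length xs))) ⟩
    ι (suc (length xs)) * c   ∎
    where
    open ≡-Reasoning
    distrib : ∀ c n → c + n * c ≡ (1ℚ + n) * c
    distrib = solve-∀ ℚ-ring

  prod-const : ∀ xs c → prodℚ xs (λ (_ : A) → c) ≡ powℚ c (length xs)
  prod-const []       c = refl
  prod-const (x ∷ xs) c = cong (c *_) (prod-const xs c)

  sum-mono-≤ : ∀ xs {f g : A → ℚ} → (∀ x → f x ≤ℚ g x) → sumℚ xs f ≤ℚ sumℚ xs g
  sum-mono-≤ []       f≤g = ℚP.≤-refl
  sum-mono-≤ (x ∷ xs) f≤g = ℚP.+-mono-≤ (f≤g x) (sum-mono-≤ xs f≤g)

  sum-nonNeg : ∀ xs {f : A → ℚ} → (∀ x → 0ℚ ≤ℚ f x) → 0ℚ ≤ℚ sumℚ xs f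
  sum-nonNeg xs {f} 0≤f = subst (_≤ℚ sumℚ xs f) (sum-0 xs) (sum-mono-≤ xs 0≤f)

  ∈⇒≤-sum : ∀ {xs x} {f : A → ℚ} → (∀ y → 0ℚ ≤ℚ f y) → x ∈ xs → f x ≤ℚ sumℚ xs f
  ∈⇒≤-sum {_ ∷ xs} 0≤f (here refl)  = p≤p+q (sum-nonNeg xs 0≤f)
  ∈⇒≤-sum {y ∷ xs} 0≤f (there x∈xs) = ℚP.≤-trans (∈⇒≤-sum 0≤f x∈xs) (p≤q+p (0≤f y))

  prod-* : ∀ xs (f g : A → ℚ) → prodℚ xs f * prodℚ xs g ≡ prodℚ xs (λ x → f x * g x)
  prod-* []       f g = refl
  prod-* (x ∷ xs) f g =
    trans (interchange (f x) (g x) (prodℚ xs f) (prodℚ xs g)) (cong (f x * g x *_) (prod-* xs f g))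
    where
    interchange : ∀ a b c d → a * c * (b * d) ≡ a * b * (c * d)
    interchange = solve-∀ ℚ-ring

  prod-nonNeg : ∀ xs {f : A → ℚ} → (∀ x → 0ℚ ≤ℚ f x) → 0ℚ ≤ℚ prodℚ xs f
  prod-nonNeg []       0≤f = 0≤1
  prod-nonNeg (x ∷ xs) 0≤f = *-nonNeg (0≤f x) (prod-nonNeg xs 0≤f)

  prod-mono-≤ : ∀ xs {f g : A → ℚ} → (∀ x → 0ℚ ≤ℚ f x) → (∀ x → f x ≤ℚ g x) →
    prodℚ xs f ≤ℚ prodℚ xs g
  prod-mono-≤ []       0≤f f≤g = ℚP.≤-refl
  prod-mono-≤ (x ∷ xs) 0≤f f≤g = *-mono-≤-nonNeg (0≤f x)
    (ℚP.≤-trans (prod-nonNeg xs 0≤f) (prod-mono-≤ xs 0≤f f≤g)) (f≤g x) (prod-mono-≤ xs 0≤f f≤g)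

  prod-𝟙 : ∀ xs (b : A → Bool) → prodℚ xs (𝟙 ∘ b) ≡ 𝟙 (foldr (λ x acc → b x ∧ acc) true xs)
  prod-𝟙 []       b = refl
  prod-𝟙 (x ∷ xs) b with b x
  ... | true  = trans (ℚP.*-identityˡ _) (prod-𝟙 xs b)
  ... | false = ℚP.*-zeroˡ (prodℚ xs (𝟙 ∘ b))

  𝟙-not-all≤sum : ∀ xs (b : A → Bool) →
    𝟙 (not (foldr (λ x acc → b x ∧ acc) true xs)) ≤ℚ sumℚ xs (λ x → 𝟙 (not (b x)))
  𝟙-not-all≤sum []       b = ℚP.≤-refl
  𝟙-not-all≤sum (x ∷ xs) b with b x
  ... | true  = subst (𝟙 (not (foldr (λ y acc → b y ∧ acc) true xs)) ≤ℚ_)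
                  (sym (ℚP.+-identityˡ _)) (𝟙-not-all≤sum xs b)
  ... | false = p≤p+q (sum-nonNeg xs (λ y → 0≤𝟙 (not (b y))))

  all-true⁻ : ∀ (b : A → Bool) {xs x} → foldr (λ y acc → b y ∧ acc) true xs ≡ true → x ∈ xs → b x ≡ true
  all-true⁻ b all (here refl)  = ∧-conicalˡ _ _ all
  all-true⁻ b all (there x∈xs) = all-true⁻ b (∧-conicalʳ _ _ all) x∈xs

  all-true⁺ : ∀ (b : A → Bool) xs → (∀ x → b x ≡ true) → foldr (λ y acc → b y ∧ acc) true xs ≡ true
  all-true⁺ b []       _   = refl
  all-true⁺ b (x ∷ xs) all = cong₂ _∧_ (all x) (all-true⁺ b xs all)

  any-true⁺ : ∀ (b : A → Bool) {xs x} → x ∈ xs → b x ≡ true → foldr (λ y acc → b y ∨ acc) false xs ≡ true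
  any-true⁺ b {_ ∷ xs} (here refl) bx = cong (_∨ foldr (λ y acc → b y ∨ acc) false xs) bx
  any-true⁺ b {y ∷ _} (there x∈xs) bx = trans (cong (b y ∨_) (any-true⁺ b x∈xs bx)) (∨-zeroʳ (b y))

  any-false⁺ : ∀ (b : A → Bool) xs → (∀ x → b x ≡ false) → foldr (λ y acc → b y ∨ acc) false xs ≡ false
  any-false⁺ b []       _    = refl
  any-false⁺ b (x ∷ xs) none = cong₂ _∨_ (none x) (any-false⁺ b xs none)

sum-swap : ∀ {A C : Set} xs (ys : List C) (f : A → C → ℚ) →
  sumℚ xs (λ x → sumℚ ys (f x)) ≡ sumℚ ys (λ y → sumℚ xs (λ x → f x y))
sum-swap []       ys f = sym (sum-0 ys)
sum-swap (x ∷ xs) ys f =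
  trans (cong (_+_ (sumℚ ys (f x))) (sum-swap xs ys f)) (sym (sum-+ ys (f x) (λ y → sumℚ xs (λ x′ → f x′ y))))

sum-map : ∀ {A C : Set} (g : C → A) xs (f : A → ℚ) → sumℚ (map g xs) f ≡ sumℚ xs (f ∘ g)
sum-map g []       f = refl
sum-map g (x ∷ xs) f = cong (_+_ (f (g x))) (sum-map g xs f)

sum-concatMap : ∀ {A C : Set} (g : C → List A) xs (f : A → ℚ) →
  sumℚ (concatMap g xs) f ≡ sumℚ xs (λ x → sumℚ (g x) f)
sum-concatMap g []       f = refl
sum-concatMap g (x ∷ xs) f =
  trans (sum-++ (g x) (concatMap g xs) f) (cong (_+_ (sumℚ (g x) f)) (sum-concatMap g xs f))

sum-*-sum : ∀ {A C : Set} xs ys (a : A → ℚ) (b : C → ℚ) →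
  sumℚ xs (λ x → sumℚ ys (λ y → a x * b y)) ≡ sumℚ xs a * sumℚ ys b
sum-*-sum xs ys a b = trans (sum-cong xs (λ x → sym (*-distribˡ-sum (a x) ys b))) (sym (*-distribʳ-sum (sumℚ ys b) xs a))

length-allFin : ∀ n → length (allFin n) ≡ n
length-allFin n = length-tabulate id

sum-const-allFin : ∀ n c → sumℚ (allFin n) (λ _ → c) ≡ ι n * c
sum-const-allFin n c = trans (sum-const (allFin n) c) (cong (λ k → ι k * c) (length-allFin n))

prod-const-allFin : ∀ n c → prodℚ (allFin n) (λ _ → c) ≡ powℚ c n
prod-const-allFin n c = trans (prod-const (allFin n) c) (cong (powℚ c) (length-allFin n))

foldr-allFin-suc : ∀ {B : Set} {n} (f : Fin (suc n) → B → B) z →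
  foldr f z (allFin (suc n)) ≡ f zero (foldr (f ∘ suc) z (allFin n))
foldr-allFin-suc {n = n} f z =
  cong (f zero) (trans (cong (foldr f z) (sym (map-tabulate id suc))) (foldr-map f suc z (allFin n)))

prod-allFin-suc : ∀ {n} (f : Fin (suc n) → ℚ) → prodℚ (allFin (suc n)) f ≡ f zero * prodℚ (allFin n) (f ∘ suc)
prod-allFin-suc f = foldr-allFin-suc (λ k acc → f k * acc) 1ℚ

prod-if-≟ : ∀ {n} (i : Fin n) c → prodℚ (allFin n) (λ k → if does (k ≟ᶠ i) then c else 1ℚ) ≡ c
prod-if-≟ {suc n} zero    c = begin
  prodℚ (allFin (suc n)) (λ k → if does (k ≟ᶠ zero) then c else 1ℚ)
    ≡⟨ prod-allFin-suc {n} (λ k → if does (k ≟ᶠ zero) then c else 1ℚ) ⟩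
  c * prodℚ (allFin n) (λ _ → 1ℚ)   ≡⟨ cong (c *_) (trans (prod-const-allFin n 1ℚ) (pow-1ˡ n)) ⟩
  c * 1ℚ                            ≡⟨ ℚP.*-identityʳ c ⟩
  c                                 ∎
  where open ≡-Reasoning
prod-if-≟ {suc n} (suc i) c =
  trans (prod-allFin-suc (λ k → if does (k ≟ᶠ suc i) then c else 1ℚ))
    (trans (ℚP.*-identityˡ _) (prod-if-≟ i c))

prod-if-∈ : ∀ {n} (Q : Subset n) c → prodℚ (allFin n) (λ k → if lookup Q k then c else 1ℚ) ≡ powℚ c ∣ Q ∣
prod-if-∈ Vec.[]          c = refl
prod-if-∈ (true Vec.∷ Q)  c =
  trans (prod-allFin-suc (λ k → if lookup (true Vec.∷ Q) k then c else 1ℚ))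
    (cong (c *_) (prod-if-∈ Q c))
prod-if-∈ (false Vec.∷ Q) c =
  trans (prod-allFin-suc (λ k → if lookup (false Vec.∷ Q) k then c else 1ℚ))
    (trans (ℚP.*-identityˡ _) (prod-if-∈ Q c))

-- Sums over all functions between finite types

sum-allFuns-suc : ∀ {A : Set} n (xs : List A) (F : (Fin (suc n) → A) → ℚ) →
  sumℚ (allFuns (suc n) xs) F ≡ sumℚ xs (λ x → sumℚ (allFuns n xs) (λ g → F (x ∷ᶠ g)))
sum-allFuns-suc n xs F = trans (sum-concatMap (λ x → map (x ∷ᶠ_) (allFuns n xs)) xs F)
  (sum-cong xs (λ x → sum-map (x ∷ᶠ_) (allFuns n xs) F))

sum-allFuns-prod : ∀ {A : Set} n (xs : List A) (W : Fin n → A → ℚ) →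
  sumℚ (allFuns n xs) (λ f → prodℚ (allFin n) (λ k → W k (f k))) ≡ prodℚ (allFin n) (λ k → sumℚ xs (W k))
sum-allFuns-prod zero    xs W = refl
sum-allFuns-prod (suc n) xs W = begin
  sumℚ (allFuns (suc n) xs) (λ f → prodℚ (allFin (suc n)) (λ k → W k (f k)))
    ≡⟨ sum-allFuns-suc n xs (λ f → prodℚ (allFin (suc n)) (λ k → W k (f k))) ⟩
  sumℚ xs (λ x → sumℚ (allFuns n xs) (λ g → prodℚ (allFin (suc n)) (λ k → W k ((x ∷ᶠ g) k))))
    ≡⟨ sum-cong xs (λ x → sum-cong (allFuns n xs) (λ g → prod-allFin-suc (λ k → W k ((x ∷ᶠ g) k)))) ⟩
  sumℚ xs (λ x → sumℚ (allFuns n xs) (λ g → W zero x * prodℚ (allFin n) (λ k → W (suc k) (g k))))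
    ≡⟨ sum-cong xs (λ x → sym (*-distribˡ-sum (W zero x) (allFuns n xs) _)) ⟩
  sumℚ xs (λ x → W zero x * sumℚ (allFuns n xs) (λ g → prodℚ (allFin n) (λ k → W (suc k) (g k))))
    ≡⟨ sum-cong xs (λ x → cong (W zero x *_) (sum-allFuns-prod n xs (W ∘ suc))) ⟩
  sumℚ xs (λ x → W zero x * prodℚ (allFin n) (λ k → sumℚ xs (W (suc k))))
    ≡⟨ sym (*-distribʳ-sum _ xs (W zero)) ⟩
  sumℚ xs (W zero) * prodℚ (allFin n) (λ k → sumℚ xs (W (suc k)))
    ≡⟨ sym (prod-allFin-suc (λ k → sumℚ xs (W k))) ⟩
  prodℚ (allFin (suc n)) (λ k → sumℚ xs (W k)) ∎
  where open ≡-Reasoning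

sum-allFuns²-prod : ∀ {A C : Set} n (xs : List A) (ys : List C) (H : A → C → ℚ) →
  sumℚ (allFuns n xs) (λ f → sumℚ (allFuns n ys) (λ g → prodℚ (allFin n) (λ k → H (f k) (g k))))
    ≡ powℚ (sumℚ xs (λ x → sumℚ ys (H x))) n
sum-allFuns²-prod n xs ys H = begin
  sumℚ (allFuns n xs) (λ f → sumℚ (allFuns n ys) (λ g → prodℚ (allFin n) (λ k → H (f k) (g k))))
    ≡⟨ sum-cong (allFuns n xs) (λ f → sum-allFuns-prod n ys (H ∘ f)) ⟩
  sumℚ (allFuns n xs) (λ f → prodℚ (allFin n) (λ k → sumℚ ys (H (f k))))
    ≡⟨ sum-allFuns-prod n xs (λ _ x → sumℚ ys (H x)) ⟩
  prodℚ (allFin n) (λ _ → sumℚ xs (λ x → sumℚ ys (H x)))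
    ≡⟨ prod-const-allFin n _ ⟩
  powℚ (sumℚ xs (λ x → sumℚ ys (H x))) n ∎
  where open ≡-Reasoning

≟-true⇒≡ : ∀ {n} {x y : Fin n} → does (x ≟ᶠ y) ≡ true → x ≡ y
≟-true⇒≡ {x = x} {y} eq with x ≟ᶠ y
... | yes x≡y = x≡y

not-≟-false : ∀ b → not (does (b ≟ᵇ false)) ≡ b
not-≟-false true  = refl
not-≟-false false = refl

𝟙-∧ : ∀ s t → 𝟙 (s ∧ t) ≡ 𝟙 s * 𝟙 t
𝟙-∧ true  t = sym (ℚP.*-identityˡ (𝟙 t))
𝟙-∧ false t = sym (ℚP.*-zeroˡ (𝟙 t))

𝟙-disjoint : ∀ a b → (b ≡ true → a ≡ false) → 𝟙 a + 𝟙 b ≤ℚ 1ℚ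
𝟙-disjoint true  true  b⇒¬a with () ← b⇒¬a refl
𝟙-disjoint true  false _    = ℚP.≤-refl
𝟙-disjoint false true  _    = ℚP.≤-refl
𝟙-disjoint false false _    = 0≤1

bools : List Bool
bools = true ∷ false ∷ []

-- The RAMBO model

module Rambo (m : ℕ) (p : ℚ) (0≤p : 0ℚ ≤ℚ p) (p<1 : p <ℚ 1ℚ) where

  B : ℕ
  B = suc m

  u : ℚ
  u = + 1 / B

  0≤u : 0ℚ ≤ℚ u
  0≤u = ℚP.<⇒≤ (0<1/suc m)

  sum-u : sumℚ (allFin B) (λ _ → u) ≡ 1ℚ
  sum-u = trans (sum-const-allFin B u) (ι-*-inverse m)

  Partition : ℕ → Set
  Partition K = Fin K → Fin B

  Flags : Set
  Flags = Fin B → Bool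

  coinProb : Bool → ℚ
  coinProb y = if y then p else 1ℚ - p

  0≤coinProb : ∀ y → 0ℚ ≤ℚ coinProb y
  0≤coinProb true  = 0≤p
  0≤coinProb false = 0≤1-p (ℚP.<⇒≤ p<1)

  weight : (K : ℕ) → Flags → ℚ
  weight K d = powℚ u K * prodℚ (allFin B) (coinProb ∘ d)

  0≤weight : ∀ K d → 0ℚ ≤ℚ weight K d
  0≤weight K d = *-nonNeg (pow-nonNeg K 0≤u) (prod-nonNeg (allFin B) (0≤coinProb ∘ d))

  -- Expectation over one repetition: a uniform partition of the K sets and independent
  -- Bernoulli(p) false-positive flags, one per cell.
  𝔼 : (K : ℕ) → (Partition K → Flags → ℚ) → ℚ
  𝔼 K X = sumℚ (allFuns K (allFin B)) λ h → sumℚ (allFuns B bools) λ d → weight K d * X h d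

  𝔼-mono-≤ : ∀ K {X Y : Partition K → Flags → ℚ} → (∀ h d → X h d ≤ℚ Y h d) → 𝔼 K X ≤ℚ 𝔼 K Y
  𝔼-mono-≤ K X≤Y = sum-mono-≤ (allFuns K (allFin B)) λ h → sum-mono-≤ (allFuns B bools) λ d →
    ℚP.*-monoˡ-≤-nonNeg (weight K d) {{ℚ.nonNegative (0≤weight K d)}} (X≤Y h d)

  𝔼-cong : ∀ K {X Y : Partition K → Flags → ℚ} → (∀ h d → X h d ≡ Y h d) → 𝔼 K X ≡ 𝔼 K Y
  𝔼-cong K X≡Y = sum-cong (allFuns K (allFin B)) λ h → sum-cong (allFuns B bools) λ d →
    cong (weight K d *_) (X≡Y h d)

  𝔼-nonNeg : ∀ K {X : Partition K → Flags → ℚ} → (∀ h d → 0ℚ ≤ℚ X h d) → 0ℚ ≤ℚ 𝔼 K X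
  𝔼-nonNeg K 0≤X = sum-nonNeg (allFuns K (allFin B)) λ h → sum-nonNeg (allFuns B bools) λ d →
    *-nonNeg (0≤weight K d) (0≤X h d)

  𝔼-0 : ∀ K → 𝔼 K (λ _ _ → 0ℚ) ≡ 0ℚ
  𝔼-0 K = trans (sum-cong (allFuns K (allFin B)) λ h →
      trans (sum-cong (allFuns B bools) λ d → ℚP.*-zeroʳ (weight K d)) (sum-0 (allFuns B bools)))
    (sum-0 (allFuns K (allFin B)))

  𝔼-+ : ∀ K (X Y : Partition K → Flags → ℚ) → 𝔼 K (λ h d → X h d + Y h d) ≡ 𝔼 K X + 𝔼 K Y
  𝔼-+ K X Y = trans
    (sum-cong (allFuns K (allFin B)) λ h → trans
      (sum-cong (allFuns B bools) λ d → ℚP.*-distribˡ-+ (weight K d) (X h d) (Y h d))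
      (sum-+ (allFuns B bools) (λ d → weight K d * X h d) (λ d → weight K d * Y h d)))
    (sum-+ (allFuns K (allFin B)) (λ h → 𝔼₁ h X) (λ h → 𝔼₁ h Y))
    where
    𝔼₁ : Partition K → (Partition K → Flags → ℚ) → ℚ
    𝔼₁ h Z = sumℚ (allFuns B bools) (λ d → weight K d * Z h d)

  𝔼-prod : ∀ K (f : Fin K → Fin B → ℚ) (g : Fin B → Bool → ℚ) →
    𝔼 K (λ h d → prodℚ (allFin K) (λ k → f k (h k)) * prodℚ (allFin B) (λ b → g b (d b)))
      ≡ prodℚ (allFin K) (λ k → sumℚ (allFin B) (λ x → u * f k x))
        * prodℚ (allFin B) (λ b → sumℚ bools (λ y → coinProb y * g b y))
  𝔼-prod K f g = begin
    𝔼 K (λ h d → F h * G d)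
      ≡⟨ sum-cong (allFuns K (allFin B)) (λ h → sum-cong (allFuns B bools) (λ d →
           interchange (powℚ u K) (prodℚ (allFin B) (coinProb ∘ d)) (F h) (G d))) ⟩
    sumℚ (allFuns K (allFin B)) (λ h → sumℚ (allFuns B bools) (λ d →
      (powℚ u K * F h) * (prodℚ (allFin B) (coinProb ∘ d) * G d)))
      ≡⟨ sum-*-sum (allFuns K (allFin B)) (allFuns B bools) (λ h → powℚ u K * F h)
                                                        (λ d → prodℚ (allFin B) (coinProb ∘ d) * G d) ⟩
    sumℚ (allFuns K (allFin B)) (λ h → powℚ u K * F h)
      * sumℚ (allFuns B bools) (λ d → prodℚ (allFin B) (coinProb ∘ d) * G d)
      ≡⟨ cong₂ _*_ partitions flags ⟩
    _ ∎
    where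
    open ≡-Reasoning
    F : Partition K → ℚ
    F h = prodℚ (allFin K) (λ k → f k (h k))
    G : Flags → ℚ
    G d = prodℚ (allFin B) (λ b → g b (d b))
    interchange : ∀ a b c d → a * b * (c * d) ≡ (a * c) * (b * d)
    interchange = solve-∀ ℚ-ring
    partitions : sumℚ (allFuns K (allFin B)) (λ h → powℚ u K * F h)
               ≡ prodℚ (allFin K) (λ k → sumℚ (allFin B) (λ x → u * f k x))
    partitions = trans
      (sum-cong (allFuns K (allFin B)) λ h → trans (cong (_* F h) (sym (prod-const-allFin K u)))
        (prod-* (allFin K) (λ _ → u) (λ k → f k (h k))))
      (sum-allFuns-prod K (allFin B) (λ k x → u * f k x))
    flags : sumℚ (allFuns B bools) (λ d → prodℚ (allFin B) (coinProb ∘ d) * G d)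
          ≡ prodℚ (allFin B) (λ b → sumℚ bools (λ y → coinProb y * g b y))
    flags = trans
      (sum-cong (allFuns B bools) λ d → prod-* (allFin B) (coinProb ∘ d) (λ b → g b (d b)))
      (sum-allFuns-prod B bools (λ b y → coinProb y * g b y))

  𝔼-1 : ∀ K → 𝔼 K (λ _ _ → 1ℚ) ≡ 1ℚ
  𝔼-1 K = begin
    𝔼 K (λ _ _ → 1ℚ)
      ≡⟨ 𝔼-cong K (λ _ _ → sym ones) ⟩
    𝔼 K (λ _ _ → prodℚ (allFin K) (λ _ → 1ℚ) * prodℚ (allFin B) (λ _ → 1ℚ))
      ≡⟨ 𝔼-prod K (λ _ _ → 1ℚ) (λ _ _ → 1ℚ) ⟩
    prodℚ (allFin K) (λ _ → sumℚ (allFin B) (λ _ → u * 1ℚ))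
      * prodℚ (allFin B) (λ _ → sumℚ bools (λ y → coinProb y * 1ℚ))
      ≡⟨ cong₂ _*_ (prod-cong (allFin K) λ _ → trans (sum-cong (allFin B) λ _ → ℚP.*-identityʳ u) sum-u)
                   (prod-cong (allFin B) λ _ → total p) ⟩
    prodℚ (allFin K) (λ _ → 1ℚ) * prodℚ (allFin B) (λ _ → 1ℚ)
      ≡⟨ ones ⟩
    1ℚ ∎
    where
    open ≡-Reasoning
    ones : prodℚ (allFin K) (λ _ → 1ℚ) * prodℚ (allFin B) (λ _ → 1ℚ) ≡ 1ℚ
    ones = cong₂ _*_ (trans (prod-const-allFin K 1ℚ) (pow-1ˡ K)) (trans (prod-const-allFin B 1ℚ) (pow-1ˡ B))
    total : ∀ p → p * 1ℚ + ((1ℚ - p) * 1ℚ + 0ℚ) ≡ 1ℚ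
    total = solve-∀ ℚ-ring

  𝔼-repetitions-independent : ∀ K R (X : Partition K → Flags → ℚ) →
    sumℚ (allFuns R (allFuns K (allFin B))) (λ φ → sumℚ (allFuns R (allFuns B bools)) (λ c →
      powℚ u (K *ℕ R) * coinWeight B R p c * prodℚ (allFin R) (λ r → X (φ r) (c r))))
      ≡ powℚ (𝔼 K X) R
  𝔼-repetitions-independent K R X = trans
    (sum-cong (allFuns R (allFuns K (allFin B))) λ φ → sum-cong (allFuns R (allFuns B bools)) λ c → split φ c)
    (sum-allFuns²-prod R (allFuns K (allFin B)) (allFuns B bools) (λ h d → weight K d * X h d))
    where
    open ≡-Reasoning
    split : ∀ φ c → powℚ u (K *ℕ R) * coinWeight B R p c * prodℚ (allFin R) (λ r → X (φ r) (c r))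
                  ≡ prodℚ (allFin R) (λ r → weight K (c r) * X (φ r) (c r))
    split φ c = begin
      powℚ u (K *ℕ R) * coinWeight B R p c * prodℚ (allFin R) (λ r → X (φ r) (c r))
        ≡⟨ cong (λ w → w * coinWeight B R p c * prodℚ (allFin R) (λ r → X (φ r) (c r)))
                (trans (pow-* u K R) (sym (prod-const-allFin R (powℚ u K)))) ⟩
      prodℚ (allFin R) (λ _ → powℚ u K) * coinWeight B R p c * prodℚ (allFin R) (λ r → X (φ r) (c r))
        ≡⟨ cong (_* prodℚ (allFin R) (λ r → X (φ r) (c r)))
                (prod-* (allFin R) (λ _ → powℚ u K) (λ r → prodℚ (allFin B) (coinProb ∘ c r))) ⟩
      prodℚ (allFin R) (λ r → weight K (c r)) * prodℚ (allFin R) (λ r → X (φ r) (c r))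
        ≡⟨ prod-* (allFin R) (λ r → weight K (c r)) (λ r → X (φ r) (c r)) ⟩
      prodℚ (allFin R) (λ r → weight K (c r) * X (φ r) (c r)) ∎

  cellPresent : ∀ {K} → Subset K → Partition K → Flags → Fin B → Bool
  cellPresent {K} Q h d b = anyᵇ K (λ j → lookup Q j ∧ does (h j ≟ᶠ b)) ∨ d b

  falsePositive : ∀ {K} → Subset K → Fin K → Partition K → Flags → Bool
  falsePositive Q i h d = not (lookup Q i) ∧ cellPresent Q h d (h i)

  cellPresent-own : ∀ {K} (Q : Subset K) h d {i} → lookup Q i ≡ true → cellPresent Q h d (h i) ≡ true
  cellPresent-own {K} Q h d {i} i∈Q = cong (_∨ d (h i))
    (any-true⁺ (λ j → lookup Q j ∧ does (h j ≟ᶠ h i)) (∈-allFin i) (cong₂ _∧_ i∈Q (dec-true (h i ≟ᶠ h i) refl)))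

  misreport≤falsePositives : ∀ {K R} (Q : Subset K) φ c i →
    𝟙 (not (does (rambo-output B K R Q φ c i ≟ᵇ lookup Q i)))
      ≤ℚ prodℚ (allFin R) (λ r → 𝟙 (falsePositive Q i (φ r) (c r)))
  misreport≤falsePositives {K} {R} Q φ c i with lookup Q i in i∈?Q
  ... | true  = subst (λ o → 𝟙 (not (does (o ≟ᵇ true))) ≤ℚ prodℚ (allFin R) (λ _ → 𝟙 false)) (sym reported)
                  (prod-nonNeg (allFin R) (λ _ → 0≤𝟙 false))
    where
    reported : rambo-output B K R Q φ c i ≡ true
    reported = all-true⁺ _ (allFin R) (λ r → cellPresent-own Q (φ r) (c r) i∈?Q)
  ... | false = ℚP.≤-reflexive (trans (cong 𝟙 (not-≟-false _))
                  (sym (prod-𝟙 (allFin R) (λ r → cellPresent Q (φ r) (c r) (φ r i)))))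

  errorProb≤sum-𝔼 : ∀ K R (Q : Subset K) →
    rambo-errorProb B K R p Q ≤ℚ sumℚ (allFin K) (λ i → powℚ (𝔼 K (λ h d → 𝟙 (falsePositive Q i h d))) R)
  errorProb≤sum-𝔼 K R Q = begin
    rambo-errorProb B K R p Q
      ≤⟨ sum-mono-≤ Φs (λ φ → sum-mono-≤ Γs (λ c →
           ℚP.*-monoˡ-≤-nonNeg (W c) {{ℚ.nonNegative (0≤W c)}} (error≤falsePositives φ c))) ⟩
    sumℚ Φs (λ φ → sumℚ Γs (λ c → W c * sumℚ (allFin K) (λ i → T i φ c)))
      ≡⟨ sum-cong Φs (λ φ → sum-cong Γs (λ c → *-distribˡ-sum (W c) (allFin K) (λ i → T i φ c))) ⟩
    sumℚ Φs (λ φ → sumℚ Γs (λ c → sumℚ (allFin K) (λ i → W c * T i φ c)))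
      ≡⟨ sum-cong Φs (λ φ → sum-swap Γs (allFin K) (λ c i → W c * T i φ c)) ⟩
    sumℚ Φs (λ φ → sumℚ (allFin K) (λ i → sumℚ Γs (λ c → W c * T i φ c)))
      ≡⟨ sum-swap Φs (allFin K) (λ φ i → sumℚ Γs (λ c → W c * T i φ c)) ⟩
    sumℚ (allFin K) (λ i → sumℚ Φs (λ φ → sumℚ Γs (λ c → W c * T i φ c)))
      ≡⟨ sum-cong (allFin K) (λ i → 𝔼-repetitions-independent K R (λ h d → 𝟙 (falsePositive Q i h d))) ⟩
    sumℚ (allFin K) (λ i → powℚ (𝔼 K (λ h d → 𝟙 (falsePositive Q i h d))) R) ∎
    where
    open ℚP.≤-Reasoning
    Φs = allFuns R (allFuns K (allFin B))
    Γs = allFuns R (allFuns B bools)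
    W : Coins B R → ℚ
    W c = powℚ u (K *ℕ R) * coinWeight B R p c
    0≤W : ∀ c → 0ℚ ≤ℚ W c
    0≤W c = *-nonNeg (pow-nonNeg (K *ℕ R) 0≤u)
      (prod-nonNeg (allFin R) (λ r → prod-nonNeg (allFin B) (0≤coinProb ∘ c r)))
    T : Fin K → Hashes B K R → Coins B R → ℚ
    T i φ c = prodℚ (allFin R) (λ r → 𝟙 (falsePositive Q i (φ r) (c r)))
    error≤falsePositives : ∀ φ c → 𝟙 (rambo-error B K R Q φ c) ≤ℚ sumℚ (allFin K) (λ i → T i φ c)
    error≤falsePositives φ c = ℚP.≤-trans
      (𝟙-not-all≤sum (allFin K) (λ i → does (rambo-output B K R Q φ c i ≟ᵇ lookup Q i)))
      (sum-mono-≤ (allFin K) (misreport≤falsePositives Q φ c))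

  hashMass-≥ : ∀ (c₀ c₁ : Fin B) s t → (s ≡ true → t ≡ false) →
    (if s then u else 1ℚ) * (if t then u else 1ℚ)
      ≤ℚ sumℚ (allFin B) (λ x → u * 𝟙 ((if s then does (x ≟ᶠ c₀) else true)
                                     ∧ (if t then does (x ≟ᶠ c₁) else true)))
  hashMass-≥ c₀ c₁ true  true  s⇒¬t with () ← s⇒¬t refl
  hashMass-≥ c₀ c₁ true  false _ =
    subst (λ z → u * 𝟙 (z ∧ true) ≤ℚ sumℚ (allFin B) f) (dec-true (c₀ ≟ᶠ c₀) refl)
      (∈⇒≤-sum (λ x → *-nonNeg 0≤u (0≤𝟙 _)) (∈-allFin c₀))
    where
    f : Fin B → ℚ
    f x = u * 𝟙 (does (x ≟ᶠ c₀) ∧ true)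
  hashMass-≥ c₀ c₁ false true  _ = subst₂ _≤ℚ_ (ℚP.*-comm u 1ℚ) refl
    (subst (λ z → u * 𝟙 z ≤ℚ sumℚ (allFin B) f) (dec-true (c₁ ≟ᶠ c₁) refl)
      (∈⇒≤-sum (λ x → *-nonNeg 0≤u (0≤𝟙 _)) (∈-allFin c₁)))
    where
    f : Fin B → ℚ
    f x = u * 𝟙 (does (x ≟ᶠ c₁))
  hashMass-≥ c₀ c₁ false false _ =
    ℚP.≤-reflexive (sym (trans (sum-cong (allFin B) (λ _ → ℚP.*-identityʳ u)) sum-u))

  flagMass : ∀ t → sumℚ bools (λ y → coinProb y * 𝟙 (if t then not y else true)) ≡ (if t then 1ℚ - p else 1ℚ)
  flagMass true  = noFlag p
    where
    noFlag : ∀ p → p * 0ℚ + ((1ℚ - p) * 1ℚ + 0ℚ) ≡ 1ℚ - p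
    noFlag = solve-∀ ℚ-ring
  flagMass false = total p
    where
    total : ∀ p → p * 1ℚ + ((1ℚ - p) * 1ℚ + 0ℚ) ≡ 1ℚ
    total = solve-∀ ℚ-ring

  module _ {K : ℕ} (Q : Subset K) {i : Fin K} (i∉Q : lookup Q i ≡ false) {c₀ c₁ : Fin B} (c₀≢c₁ : ¬ c₀ ≡ c₁) where

    goodHash : Fin K → Fin B → Bool
    goodHash k x = (if does (k ≟ᶠ i) then does (x ≟ᶠ c₀) else true)
                 ∧ (if lookup Q k then does (x ≟ᶠ c₁) else true)

    goodFlag : Fin B → Bool → Bool
    goodFlag b y = if does (b ≟ᶠ c₀) then not y else true

    good : Partition K → Flags → Bool
    good h d = allᵇ K (λ k → goodHash k (h k)) ∧ allᵇ B (λ b → goodFlag b (d b))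

    good⇒cellAbsent : ∀ h d → good h d ≡ true → cellPresent Q h d (h i) ≡ false
    good⇒cellAbsent h d isGood = cong₂ _∨_ (any-false⁺ _ (allFin K) emptyCell) (trans (cong d hᵢ≡c₀) noFlag)
      where
      hashOK : allᵇ K (λ k → goodHash k (h k)) ≡ true
      hashOK = ∧-conicalˡ _ (allᵇ B (λ b → goodFlag b (d b))) isGood
      flagOK : allᵇ B (λ b → goodFlag b (d b)) ≡ true
      flagOK = ∧-conicalʳ (allᵇ K (λ k → goodHash k (h k))) _ isGood
      goodAt : ∀ k → goodHash k (h k) ≡ true
      goodAt k = all-true⁻ (λ k → goodHash k (h k)) hashOK (∈-allFin k)
      hᵢ≡c₀ : h i ≡ c₀
      hᵢ≡c₀ = ≟-true⇒≡ (subst (λ s → (if s then does (h i ≟ᶠ c₀) else true) ≡ true)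
        (dec-true (i ≟ᶠ i) refl) (∧-conicalˡ _ _ (goodAt i)))
      hⱼ≡c₁ : ∀ {j} → lookup Q j ≡ true → h j ≡ c₁
      hⱼ≡c₁ {j} j∈Q = ≟-true⇒≡ (subst (λ t → (if t then does (h j ≟ᶠ c₁) else true) ≡ true)
        j∈Q (∧-conicalʳ _ _ (goodAt j)))
      noFlag : d c₀ ≡ false
      noFlag = not-injective (subst (λ s → (if s then not (d c₀) else true) ≡ true) (dec-true (c₀ ≟ᶠ c₀) refl)
        (all-true⁻ (λ b → goodFlag b (d b)) flagOK (∈-allFin c₀)))
      emptyCell : ∀ j → lookup Q j ∧ does (h j ≟ᶠ h i) ≡ false
      emptyCell j with lookup Q j in j∈?Q
      ... | false = refl
      ... | true  = dec-false (h j ≟ᶠ h i) λ hⱼ≡hᵢ →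
                      c₀≢c₁ (trans (sym hᵢ≡c₀) (trans (sym hⱼ≡hᵢ) (hⱼ≡c₁ j∈?Q)))

    𝔼-good : 𝔼 K (λ h d → 𝟙 (good h d))
           ≡ prodℚ (allFin K) (λ k → sumℚ (allFin B) (λ x → u * 𝟙 (goodHash k x))) * (1ℚ - p)
    𝔼-good = begin
      𝔼 K (λ h d → 𝟙 (good h d))
        ≡⟨ 𝔼-cong K (λ h d → trans (𝟙-∧ (hashOK h) (flagOK d))
             (sym (cong₂ _*_ (prod-𝟙 (allFin K) (λ k → goodHash k (h k)))
                             (prod-𝟙 (allFin B) (λ b → goodFlag b (d b)))))) ⟩
      𝔼 K (λ h d → prodℚ (allFin K) (λ k → 𝟙 (goodHash k (h k)))
                 * prodℚ (allFin B) (λ b → 𝟙 (goodFlag b (d b))))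
        ≡⟨ 𝔼-prod K (λ k x → 𝟙 (goodHash k x)) (λ b y → 𝟙 (goodFlag b y)) ⟩
      hashMass * prodℚ (allFin B) (λ b → sumℚ bools (λ y → coinProb y * 𝟙 (goodFlag b y)))
        ≡⟨ cong (hashMass *_) (trans (prod-cong (allFin B) (λ b → flagMass (does (b ≟ᶠ c₀))))
                                     (prod-if-≟ c₀ (1ℚ - p))) ⟩
      hashMass * (1ℚ - p) ∎
      where
      open ≡-Reasoning
      hashOK : Partition K → Bool
      hashOK h = allᵇ K (λ k → goodHash k (h k))
      flagOK : Flags → Bool
      flagOK d = allᵇ B (λ b → goodFlag b (d b))
      hashMass : ℚ
      hashMass = prodℚ (allFin K) (λ k → sumℚ (allFin B) (λ x → u * 𝟙 (goodHash k x)))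

    good-mass : powℚ u (suc ∣ Q ∣) * (1ℚ - p) ≤ℚ 𝔼 K (λ h d → 𝟙 (good h d))
    good-mass = begin
      powℚ u (suc ∣ Q ∣) * (1ℚ - p)
        ≡⟨ cong (_* (1ℚ - p)) (trans (sym (cong₂ _*_ (prod-if-≟ i u) (prod-if-∈ Q u)))
                                     (prod-* (allFin K) own inQ)) ⟩
      prodℚ (allFin K) (λ k → own k * inQ k) * (1ℚ - p)
        ≤⟨ ℚP.*-monoʳ-≤-nonNeg (1ℚ - p) {{ℚ.nonNegative (0≤1-p (ℚP.<⇒≤ p<1))}}
             (prod-mono-≤ (allFin K) (λ k → *-nonNeg (0≤if (does (k ≟ᶠ i))) (0≤if (lookup Q k)))
               (λ k → hashMass-≥ c₀ c₁ (does (k ≟ᶠ i)) (lookup Q k)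
                        (λ k≟i → subst (λ j → lookup Q j ≡ false) (sym (≟-true⇒≡ k≟i)) i∉Q))) ⟩
      prodℚ (allFin K) (λ k → sumℚ (allFin B) (λ x → u * 𝟙 (goodHash k x))) * (1ℚ - p)
        ≡⟨ sym 𝔼-good ⟩
      𝔼 K (λ h d → 𝟙 (good h d)) ∎
      where
      open ℚP.≤-Reasoning
      own inQ : Fin K → ℚ
      own k = if does (k ≟ᶠ i) then u else 1ℚ
      inQ k = if lookup Q k then u else 1ℚ
      0≤if : ∀ t → 0ℚ ≤ℚ (if t then u else 1ℚ)
      0≤if true  = 0≤u
      0≤if false = 0≤1

    𝔼-falsePositive-∉ : 𝔼 K (λ h d → 𝟙 (falsePositive Q i h d)) ≤ℚ 1ℚ - powℚ u (suc ∣ Q ∣) * (1ℚ - p)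
    𝔼-falsePositive-∉ = +≤1⇒≤1- (begin
      𝔼 K (λ h d → 𝟙 (falsePositive Q i h d)) + 𝔼 K (λ h d → 𝟙 (good h d))
        ≡⟨ sym (𝔼-+ K _ _) ⟩
      𝔼 K (λ h d → 𝟙 (falsePositive Q i h d) + 𝟙 (good h d))
        ≤⟨ 𝔼-mono-≤ K (λ h d → 𝟙-disjoint _ _ λ isGood →
             cong₂ (λ a b → not a ∧ b) i∉Q (good⇒cellAbsent h d isGood)) ⟩
      𝔼 K (λ _ _ → 1ℚ)
        ≡⟨ 𝔼-1 K ⟩
      1ℚ ∎) good-mass
      where open ℚP.≤-Reasoning

  ε : ℕ → ℚ
  ε V = powℚ u (suc V) * (1ℚ - p)

  0<ε : ∀ V → 0ℚ <ℚ ε V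
  0<ε V = *-pos (pow-pos (suc V) (0<1/suc m)) (0<1-p p<1)

  ε≤1 : ∀ V → ε V ≤ℚ 1ℚ
  ε≤1 V = *-mono-≤-nonNeg (pow-nonNeg (suc V) 0≤u) 0≤1 (pow-≤1 (suc V) 0≤u (1/suc≤1 m)) (1-p≤1 0≤p)

  𝔼-falsePositive≤ : ∀ {K} (Q : Subset K) i {c₀ c₁ : Fin B} → ¬ c₀ ≡ c₁ →
    𝔼 K (λ h d → 𝟙 (falsePositive Q i h d)) ≤ℚ 1ℚ - ε ∣ Q ∣
  𝔼-falsePositive≤ {K} Q i c₀≢c₁ = byMembership (lookup Q i) refl
    where
    byMembership : ∀ t → lookup Q i ≡ t → 𝔼 K (λ h d → 𝟙 (falsePositive Q i h d)) ≤ℚ 1ℚ - ε ∣ Q ∣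
    byMembership false i∉Q = 𝔼-falsePositive-∉ Q i∉Q c₀≢c₁
    byMembership true  i∈Q = subst (_≤ℚ 1ℚ - ε ∣ Q ∣)
      (sym (trans (𝔼-cong K (λ h d → cong (λ t → 𝟙 (not t ∧ cellPresent Q h d (h i))) i∈Q)) (𝔼-0 K)))
      (0≤1-p (ε≤1 ∣ Q ∣))

  errorProb≤ : ∀ {c₀ c₁ : Fin B} → ¬ c₀ ≡ c₁ → ∀ K R {V} (Q : Subset K) → ∣ Q ∣ ≤ V →
    rambo-errorProb B K R p Q ≤ℚ ι K * powℚ (1ℚ - ε V) R
  errorProb≤ c₀≢c₁ K R {V} Q |Q|≤V = begin
    rambo-errorProb B K R p Q
      ≤⟨ errorProb≤sum-𝔼 K R Q ⟩
    sumℚ (allFin K) (λ i → powℚ (𝔼 K (λ h d → 𝟙 (falsePositive Q i h d))) R)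
      ≤⟨ sum-mono-≤ (allFin K) (λ i → pow-mono-≤ R (𝔼-nonNeg K (λ h d → 0≤𝟙 (falsePositive Q i h d)))
           (ℚP.≤-trans (𝔼-falsePositive≤ Q i c₀≢c₁) 1-ε-mono)) ⟩
    sumℚ (allFin K) (λ _ → powℚ (1ℚ - ε V) R)
      ≡⟨ sum-const-allFin K (powℚ (1ℚ - ε V) R) ⟩
    ι K * powℚ (1ℚ - ε V) R ∎
    where
    open ℚP.≤-Reasoning
    1-ε-mono : 1ℚ - ε ∣ Q ∣ ≤ℚ 1ℚ - ε V
    1-ε-mono = ℚP.+-monoʳ-≤ 1ℚ (ℚP.neg-antimono-≤
      (ℚP.*-monoʳ-≤-nonNeg (1ℚ - p) {{ℚ.nonNegative (0≤1-p (ℚP.<⇒≤ p<1))}}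
        (pow-antimonoʳ-≤ 0≤u (1/suc≤1 m) (s≤s |Q|≤V))))

theorem4p3 : (B : ℕ) → .{{_ : NonZero B}} → 2 ≤ B → (p : ℚ) → 0ℚ ≤ℚ p → p <ℚ 1ℚ → (V : ℕ) →
    ∃[ C ] ((K R : ℕ) → (δ : ℚ) → 0ℚ <ℚ δ → δ <ℚ 1ℚ →
      powℚ (+ K / 1) C ≤ℚ powℚ δ C * powℚ (+ 2 / 1) R →
      (Q : Subset K) → ∣ Q ∣ ≤ V → rambo-errorProb B K R p Q ≤ℚ δ)
theorem4p3 (suc (suc b)) (s≤s (s≤s z≤n)) p 0≤p p<1 V =
  C , λ K R δ 0<δ _ Kᶜ≤δᶜ2ᴿ Q |Q|≤V →
    ℚP.≤-trans (errorProb≤ {zero} {suc zero} (λ ()) K R Q |Q|≤V) (decay K R δ (ℚP.<⇒≤ 0<δ) Kᶜ≤δᶜ2ᴿ)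
  where
  open Rambo (suc b) p 0≤p p<1
  open Σ (geometric-tail (0<ε V) (ε≤1 V)) renaming (proj₁ to C; proj₂ to decay)
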